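{- Let $\mathcal{C}$ be an admissible configuration of points and $\underline{v_{\mathcal{C}}}$ its associated word. Then (1) $\underline{v_{\mathcal{C}}}$ is a reduced expression of some permutation $v_{\mathcal{C}}$; (2) $v_{\mathcal{C}}$ is $321$-avoiding; (3) $v_{\mathcal{C}}$ is $2$-repeating.
   Context: Work in a symmetric group $\mathfrak{S}_N$ ($N$ large enough) with Coxeter generators $s_i=(i,i+1)$. Let $\mathcal{T}=\{(i,j)\in\mathbb{Z}^2 : j\le 0,\ |i|\le|j|,\ i\equiv j \bmod 2\}$; a configuration of points is a finite subset of $\mathcal{T}$. A configuration $\mathcal{C}$ is admissible if: (a) no three points of $\mathcal{C}$ have the same $y$-coordinate; (b) if $(i_1,j_1),(i_2,j_2)\in\mathcal{C}$ are distinct with $j_1=j_2$ then $|i_1-i_2|=2$; (c) if $(i_1,j_1),(i_2,j_2)\in\mathcal{C}$ with $j_1=j_2$ and $i_1<i_2$, then $(i_1+1,j_1+1)$ and $(i_1+1,j_1-1)$ belong to $\mathcal{C}$. To a point $(i,j)$ associate the letter $s_{1-j}$; the word $\underline{v_{\mathcal{C}}}$ is obtained by reading the points of $\mathcal{C}$ from left to right and from top to bottom (i.e. by increasing $x$-coordinate, and within the same $x$-coordinate by decreasing $y$-coordinate). A permutation is $321$-avoiding if no reduced expression of it contains a subword of consecutive letters of the form $s_is_{i\pm1}s_i$; for such $v$ the number $n_v(i)$ of occurrences of $s_i$ in a reduced expression is independent of the expression, and $v$ is $2$-repeating if $n_v(i)\le 2$ for all $i$. -}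

module Defs where

open import Data.Nat as ℕ using (ℕ; zero; suc)
open import Data.Nat.Properties using (_≟_)
open import Data.Integer as ℤ using (ℤ; +_; ∣_∣)
open import Data.Integer.Divisibility using () renaming (_∣_ to _∣ℤ_)
open import Data.Product using (_×_; _,_; Σ; ∃; ∃-syntax; proj₁; proj₂)
open import Data.Sum using (_⊎_)
open import Data.List using (List; []; _∷_; _++_; length; map; filter)
open import Data.List.Membership.Propositional using (_∈_)
open import Data.List.Relation.Unary.All using (All)
open import Data.List.Relation.Unary.AllPairs using (AllPairs)
open import Relation.Binary.PropositionalEquality using (_≡_; _≢_)
open import Relation.Nullary using (¬_; yes; no)

-- A letter k stands for the Coxeter generator s_k = (k, k+1).
-- It is a generator of S_N iff 1 ≤ k and k + 1 ≤ N.
Gen : ℕ → ℕ → Set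
Gen N k = 1 ℕ.≤ k × k ℕ.< N

Word : Set
Word = List ℕ

ValidWord : ℕ → Word → Set
ValidWord N w = All (Gen N) w

swap : ℕ → ℕ → ℕ
swap k n with n ≟ k
... | yes _ = suc k
... | no _ with n ≟ suc k
...   | yes _ = k
...   | no _ = n

-- the permutation represented by a word: s_{k1} s_{k2} ... s_{km}
-- (product of functions, composed right to left)
perm : Word → ℕ → ℕ
perm [] n = n
perm (k ∷ w) n = swap k (perm w n)

_≈w_ : Word → Word → Set
w ≈w w' = ∀ n → perm w n ≡ perm w' n

Reduced : ℕ → Word → Set
Reduced N w = ∀ w' → ValidWord N w' → w' ≈w w → length w ℕ.≤ length w'

Has321Factor : Word → Set
Has321Factor w = ∃[ a ] ∃[ b ] ∃[ i ] ∃[ j ]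
  ((j ≡ suc i ⊎ i ≡ suc j) × w ≡ a ++ (i ∷ j ∷ i ∷ []) ++ b)

-- the permutation represented by w is 321-avoiding: no reduced
-- expression of it contains s_i s_{i±1} s_i as consecutive letters
Avoids321 : ℕ → Word → Set
Avoids321 N w = ∀ w' → ValidWord N w' → w' ≈w w → Reduced N w' → ¬ Has321Factor w'

count : ℕ → Word → ℕ
count i w = length (filter (_≟ i) w)

TwoRepeating : ℕ → Word → Set
TwoRepeating N w = ∀ w' → ValidWord N w' → w' ≈w w → Reduced N w' →
  ∀ i → count i w' ℕ.≤ 2

Point : Set
Point = ℤ × ℤ

xc : Point → ℤ
xc = proj₁

yc : Point → ℤ
yc = proj₂

InT : Point → Set
InT (i , j) = j ℤ.≤ + 0 × ∣ i ∣ ℕ.≤ ∣ j ∣ × (+ 2) ∣ℤ (i ℤ.- j)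

_≺_ : Point → Point → Set
p ≺ q = xc p ℤ.< xc q ⊎ (xc p ≡ xc q × yc q ℤ.< yc p)

letter : Point → ℕ
letter (i , j) = ∣ + 1 ℤ.- j ∣

-- A finite configuration is represented by the list of its points
-- in reading order (strictly increasing for ≺, hence duplicate-free).
Admissible : List Point → Set
Admissible C =
  (∀ {p q r} → p ∈ C → q ∈ C → r ∈ C → p ≢ q → q ≢ r → p ≢ r →
     ¬ (yc p ≡ yc q × yc q ≡ yc r))
  × (∀ {p q} → p ∈ C → q ∈ C → p ≢ q → yc p ≡ yc q →
       ∣ xc p ℤ.- xc q ∣ ≡ 2)
  × (∀ {p q} → p ∈ C → q ∈ C → yc p ≡ yc q → xc p ℤ.< xc q →
       ((xc p ℤ.+ + 1 , yc p ℤ.+ + 1) ∈ C) ×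
       ((xc p ℤ.+ + 1 , yc p ℤ.- + 1) ∈ C))

wordOf : List Point → Word
wordOf C = map letter C

-- For a permutation g let cut k g be the number of a ≤ k with g a > k, the strands of g
-- crossing the gap between positions k and k + 1.  Composing with s_j leaves cut k unchanged
-- for j ≢ k and moves it by at most one for j ≡ k, so cut k v ≤ count k w for every word w
-- of v, and summing over k bounds the length of every word of v from below.
-- Say that the letter k crosses the word u following it if u⁻¹ k ≤ k < u⁻¹ (k + 1); exactly
-- then s_k u has one more crossing at k than u.  If every letter of w crosses its suffix,
-- count k w = cut k v for all k: w is reduced, every reduced word w' of v satisfies the same
-- equalities (so count k w' ≤ count k w), and no s_i s_(i±1) s_i occurs in w', since the
-- second s_i would not cross.
-- For the word of an admissible configuration, let p have letter k.  The only later point on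
-- p's row is p + (2,0), and by parity the only later points on the adjacent rows before it are
-- p + (1,±1).  If p + (2,0) is absent no later letter is k; otherwise condition (c) puts
-- p + (1,1) and p + (1,-1) before it, and they send the strands through k and k + 1 to the
-- correct sides before the letter k of p + (2,0) is read.  Finally the letter of a point
-- determines its row, and no row holds three points.

module Submission where

open import Defs
open import Algebra.Properties.CommutativeSemigroup using (interchange)
open import Data.Empty using (⊥; ⊥-elim)
open import Data.Integer as ℤ using (ℤ; +_; -[1+_]; ∣_∣; +≤+; +<+; -<+)
open import Data.Integer.Divisibility using () renaming (_∣_ to _∣ℤ_)
open import Data.Integer.Divisibility.Signed using (∣ᵤ⇒∣; ∣⇒∣ᵤ; ∣m+n∣m⇒∣n)
import Data.Integer.Properties as ℤₚ
open import Data.Integer.Tactic.RingSolver using (solve-∀)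
open import Data.List using (List; []; _∷_; _++_; map; filter; length)
open import Data.List.Membership.Propositional using (_∈_)
open import Data.List.Membership.Propositional.Properties using (∈-∃++; ∈-++⁻; ∈-++⁺ʳ; ∈-filter⁻)
open import Data.List.Properties using (map-++; ++-assoc; ++-identityʳ; filter-accept; filter-reject; filter-++; length-++)
open import Data.List.Relation.Unary.All as All using (All; []; _∷_)
import Data.List.Relation.Unary.All.Properties as Allₚ
open import Data.List.Relation.Unary.AllPairs using (AllPairs; []; _∷_)
open import Data.List.Relation.Unary.AllPairs.Properties using (filter⁺)
open import Data.List.Relation.Unary.Any using (here; there)
open import Data.Nat using (ℕ; zero; suc; _+_; _≤_; _<_; z≤n; s≤s; _<?_)
open import Data.Nat.Divisibility using (∣⇒≤)
open import Data.Nat.Properties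
open import Data.Product using (_×_; _,_; ∃-syntax; ∃₂; proj₁; proj₂)
open import Data.Product.Properties using (≡-dec)
open import Data.List.Membership.DecPropositional (≡-dec ℤ._≟_ ℤ._≟_) using (_∈?_)
open import Data.Sum using (_⊎_; inj₁; inj₂)
open import Data.Unit using (⊤)
open import Function using (_∘_)
open import Relation.Binary.Core using (Rel)
open import Relation.Binary.Definitions using (Asymmetric)
open import Relation.Binary.PropositionalEquality
open import Relation.Nullary using (¬_; Dec; yes; no)

-- Adjacent transpositions and the inverse action of a word

swap-left : ∀ k → swap k k ≡ suc k
swap-left k with k ≟ k
... | yes _ = refl
... | no k≢k = ⊥-elim (k≢k refl)

swap-right : ∀ k → swap k (suc k) ≡ k
swap-right k with suc k ≟ k
... | yes 1+k≡k = ⊥-elim (1+n≢n 1+k≡k)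
... | no _ with suc k ≟ suc k
...   | yes _ = refl
...   | no 1+k≢1+k = ⊥-elim (1+k≢1+k refl)

swap-fixes : ∀ {k n} → n ≢ k → n ≢ suc k → swap k n ≡ n
swap-fixes {k} {n} n≢k n≢1+k with n ≟ k
... | yes n≡k = ⊥-elim (n≢k n≡k)
... | no _ with n ≟ suc k
...   | yes n≡1+k = ⊥-elim (n≢1+k n≡1+k)
...   | no _ = refl

swap-involutive : ∀ k n → swap k (swap k n) ≡ n
swap-involutive k n with n ≟ k
... | yes refl = swap-right k
... | no n≢k with n ≟ suc k
...   | yes refl = swap-left k
...   | no n≢1+k = swap-fixes n≢k n≢1+k

swap-≤ : ∀ {j k v} → j ≢ k → v ≤ k → swap j v ≤ k
swap-≤ {j} {k} {v} j≢k v≤k with v ≟ j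
... | yes refl = ≤∧≢⇒< v≤k j≢k
... | no v≢j with v ≟ suc j
...   | yes refl = ≤-trans (n≤1+n j) v≤k
...   | no _ = v≤k

swap-> : ∀ {j k v} → j ≢ k → k < v → k < swap j v
swap-> {j} {k} {v} j≢k k<v with v ≟ j
... | yes refl = m≤n⇒m≤1+n k<v
... | no v≢j with v ≟ suc j
...   | yes refl = ≤∧≢⇒< (≤-pred k<v) (j≢k ∘ sym)
...   | no _ = k<v

perm⁻¹ : Word → ℕ → ℕ
perm⁻¹ [] n = n
perm⁻¹ (k ∷ w) n = perm⁻¹ w (swap k n)

perm-perm⁻¹ : ∀ w n → perm w (perm⁻¹ w n) ≡ n
perm-perm⁻¹ [] n = refl
perm-perm⁻¹ (k ∷ w) n = trans (cong (swap k) (perm-perm⁻¹ w (swap k n))) (swap-involutive k n)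

perm⁻¹-perm : ∀ w n → perm⁻¹ w (perm w n) ≡ n
perm⁻¹-perm [] n = refl
perm⁻¹-perm (k ∷ w) n = trans (cong (perm⁻¹ w) (swap-involutive k (perm w n))) (perm⁻¹-perm w n)

perm⁻¹-++ : ∀ u v n → perm⁻¹ (u ++ v) n ≡ perm⁻¹ v (perm⁻¹ u n)
perm⁻¹-++ [] v n = refl
perm⁻¹-++ (k ∷ u) v n = perm⁻¹-++ u v (swap k n)

perm⁻¹-≤ : ∀ {k v} w → All (_≢ k) w → v ≤ k → perm⁻¹ w v ≤ k
perm⁻¹-≤ [] [] v≤k = v≤k
perm⁻¹-≤ (j ∷ w) (j≢k ∷ w≢k) v≤k = perm⁻¹-≤ w w≢k (swap-≤ j≢k v≤k)

perm⁻¹-> : ∀ {k v} w → All (_≢ k) w → k < v → k < perm⁻¹ w v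
perm⁻¹-> [] [] k<v = k<v
perm⁻¹-> (j ∷ w) (j≢k ∷ w≢k) k<v = perm⁻¹-> w w≢k (swap-> j≢k k<v)

perm⁻¹-pinned : ∀ {k} w → All (_≢ k) w → All (_≢ suc k) w → perm⁻¹ w (suc k) ≡ suc k
perm⁻¹-pinned w w≢k w≢1+k = ≤-antisym (perm⁻¹-≤ w w≢1+k ≤-refl) (perm⁻¹-> w w≢k ≤-refl)

Crosses : ℕ → Word → Set
Crosses k w = perm⁻¹ w k ≤ k × k < perm⁻¹ w (suc k)

LettersCross : Word → Set
LettersCross [] = ⊤
LettersCross (k ∷ w) = Crosses k w × LettersCross w

crosses-of-avoiding : ∀ {k} w → All (_≢ k) w → Crosses k w
crosses-of-avoiding w w≢k = perm⁻¹-≤ w w≢k ≤-refl , perm⁻¹-> w w≢k ≤-refl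

crosses₁-of-pattern : ∀ {a k} u₁ u₂ w → suc a ≡ k →
  All (_≢ a) u₁ → All (_≢ k) u₁ → All (_≢ a) u₂ → All (_≢ k) w →
  perm⁻¹ ((u₁ ++ a ∷ u₂) ++ k ∷ w) k ≤ k
crosses₁-of-pattern {a} u₁ u₂ w refl u₁≢a u₁≢k u₂≢a w≢k = begin
  perm⁻¹ ((u₁ ++ a ∷ u₂) ++ suc a ∷ w) (suc a)        ≡⟨ perm⁻¹-++ (u₁ ++ a ∷ u₂) (suc a ∷ w) (suc a) ⟩
  perm⁻¹ w (swap (suc a) (perm⁻¹ (u₁ ++ a ∷ u₂) (suc a)))
    ≡⟨ cong (perm⁻¹ w ∘ swap (suc a)) (perm⁻¹-++ u₁ (a ∷ u₂) (suc a)) ⟩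
  perm⁻¹ w (swap (suc a) (perm⁻¹ u₂ (swap a (perm⁻¹ u₁ (suc a)))))
    ≡⟨ cong (λ n → perm⁻¹ w (swap (suc a) (perm⁻¹ u₂ (swap a n)))) (perm⁻¹-pinned u₁ u₁≢a u₁≢k) ⟩
  perm⁻¹ w (swap (suc a) (perm⁻¹ u₂ (swap a (suc a))))
    ≡⟨ cong (λ n → perm⁻¹ w (swap (suc a) (perm⁻¹ u₂ n))) (swap-right a) ⟩
  perm⁻¹ w (swap (suc a) (perm⁻¹ u₂ a))
    ≤⟨ perm⁻¹-≤ w w≢k (m≤n⇒m≤1+n (swap-≤ 1+n≢n (perm⁻¹-≤ u₂ u₂≢a ≤-refl))) ⟩
  suc a                                                ∎
  where open ≤-Reasoning

crosses₂-of-pattern : ∀ {k b} u₁ u₂ w → b ≡ suc k →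
  All (_≢ k) u₁ → All (_≢ b) u₁ → All (_≢ b) u₂ → All (_≢ k) w →
  k < perm⁻¹ ((u₁ ++ b ∷ u₂) ++ k ∷ w) (suc k)
crosses₂-of-pattern {k} u₁ u₂ w refl u₁≢k u₁≢b u₂≢b w≢k = begin-strict
  k
    <⟨ perm⁻¹-> w w≢k (<-trans (n<1+n k) (swap-> (<⇒≢ (n<1+n k)) (perm⁻¹-> u₂ u₂≢b ≤-refl))) ⟩
  perm⁻¹ w (swap k (perm⁻¹ u₂ (suc (suc k))))
    ≡⟨ cong (λ n → perm⁻¹ w (swap k (perm⁻¹ u₂ n))) (swap-left (suc k)) ⟨
  perm⁻¹ w (swap k (perm⁻¹ u₂ (swap (suc k) (suc k))))
    ≡⟨ cong (λ n → perm⁻¹ w (swap k (perm⁻¹ u₂ (swap (suc k) n)))) (perm⁻¹-pinned u₁ u₁≢k u₁≢b) ⟨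
  perm⁻¹ w (swap k (perm⁻¹ u₂ (swap (suc k) (perm⁻¹ u₁ (suc k)))))
    ≡⟨ cong (perm⁻¹ w ∘ swap k) (perm⁻¹-++ u₁ (suc k ∷ u₂) (suc k)) ⟨
  perm⁻¹ w (swap k (perm⁻¹ (u₁ ++ suc k ∷ u₂) (suc k)))      ≡⟨ perm⁻¹-++ (u₁ ++ suc k ∷ u₂) (k ∷ w) (suc k) ⟨
  perm⁻¹ ((u₁ ++ suc k ∷ u₂) ++ k ∷ w) (suc k)               ∎
  where open ≤-Reasoning

-- Crossing numbers

⟦_<_⟧ : ℕ → ℕ → ℕ
⟦ _ < zero ⟧ = 0
⟦ zero < suc n ⟧ = 1
⟦ suc m < suc n ⟧ = ⟦ m < n ⟧

⟦_≡_⟧ : ℕ → ℕ → ℕ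
⟦ zero ≡ zero ⟧ = 1
⟦ zero ≡ suc n ⟧ = 0
⟦ suc m ≡ zero ⟧ = 0
⟦ suc m ≡ suc n ⟧ = ⟦ m ≡ n ⟧

⟦<⟧-yes : ∀ {m n} → m < n → ⟦ m < n ⟧ ≡ 1
⟦<⟧-yes {zero} (s≤s _) = refl
⟦<⟧-yes {suc m} (s≤s m<n) = ⟦<⟧-yes m<n

⟦<⟧-no : ∀ {m n} → n ≤ m → ⟦ m < n ⟧ ≡ 0
⟦<⟧-no {n = zero} _ = refl
⟦<⟧-no (s≤s n≤m) = ⟦<⟧-no n≤m

⟦≡⟧-yes : ∀ n → ⟦ n ≡ n ⟧ ≡ 1
⟦≡⟧-yes zero = refl
⟦≡⟧-yes (suc n) = ⟦≡⟧-yes n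

⟦≡⟧-no : ∀ {m n} → m ≢ n → ⟦ m ≡ n ⟧ ≡ 0
⟦≡⟧-no {zero} {zero} m≢n = ⊥-elim (m≢n refl)
⟦≡⟧-no {zero} {suc n} _ = refl
⟦≡⟧-no {suc m} {zero} _ = refl
⟦≡⟧-no {suc m} {suc n} m≢n = ⟦≡⟧-no (m≢n ∘ cong suc)

⟦<⟧-suc : ∀ m n → ⟦ m < suc n ⟧ ≡ ⟦ m ≡ n ⟧ + ⟦ m < n ⟧
⟦<⟧-suc zero zero = refl
⟦<⟧-suc zero (suc n) = refl
⟦<⟧-suc (suc m) zero = refl
⟦<⟧-suc (suc m) (suc n) = ⟦<⟧-suc m n

⟦<⟧≤1 : ∀ m n → ⟦ m < n ⟧ ≤ 1
⟦<⟧≤1 m zero = z≤n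
⟦<⟧≤1 zero (suc n) = ≤-refl
⟦<⟧≤1 (suc m) (suc n) = ⟦<⟧≤1 m n

⟦<⟧-pos : ∀ {m n} → 1 ≤ ⟦ m < n ⟧ → m < n
⟦<⟧-pos {zero} {suc n} _ = s≤s z≤n
⟦<⟧-pos {suc m} {suc n} p = s≤s (⟦<⟧-pos p)

⟦<⟧-zero : ∀ {m n} → ⟦ m < n ⟧ ≡ 0 → n ≤ m
⟦<⟧-zero {n = zero} _ = z≤n
⟦<⟧-zero {suc m} {suc n} p = s≤s (⟦<⟧-zero p)

sumBelow : ℕ → (ℕ → ℕ) → ℕ
sumBelow zero f = 0
sumBelow (suc n) f = f n + sumBelow n f

sumBelow-0 : ∀ n → sumBelow n (λ _ → 0) ≡ 0
sumBelow-0 zero = refl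
sumBelow-0 (suc n) = sumBelow-0 n

sumBelow-cong : ∀ {f g} n → (∀ a → f a ≡ g a) → sumBelow n f ≡ sumBelow n g
sumBelow-cong zero f≗g = refl
sumBelow-cong (suc n) f≗g = cong₂ _+_ (f≗g n) (sumBelow-cong n f≗g)

sumBelow-mono : ∀ {f g} n → (∀ a → f a ≤ g a) → sumBelow n f ≤ sumBelow n g
sumBelow-mono zero f≤g = z≤n
sumBelow-mono (suc n) f≤g = +-mono-≤ (f≤g n) (sumBelow-mono n f≤g)

sumBelow-+ : ∀ f g n → sumBelow n (λ a → f a + g a) ≡ sumBelow n f + sumBelow n g
sumBelow-+ f g zero = refl
sumBelow-+ f g (suc n) =
  trans (cong (λ t → f n + g n + t) (sumBelow-+ f g n)) (interchange +-commutativeSemigroup (f n) (g n) (sumBelow n f) (sumBelow n g))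

sumBelow-tight : ∀ {f g} n → (∀ a → f a ≤ g a) → sumBelow n g ≤ sumBelow n f → ∀ {a} → a < n → g a ≤ f a
sumBelow-tight {f} {g} (suc n) f≤g Σg≤Σf {a} a<1+n with a ≟ n
... | yes refl = +-cancelʳ-≤ _ _ _ (≤-trans (+-monoʳ-≤ (g a) (sumBelow-mono n f≤g)) Σg≤Σf)
... | no a≢n = sumBelow-tight n f≤g
  (+-cancelˡ-≤ _ _ _ (≤-trans (+-monoˡ-≤ (sumBelow n g) (f≤g n)) Σg≤Σf)) (≤∧≢⇒< (≤-pred a<1+n) a≢n)

sumBelow-⟦≡⟧ : ∀ t n → sumBelow n (λ a → ⟦ t ≡ a ⟧) ≡ ⟦ t < n ⟧
sumBelow-⟦≡⟧ t zero = refl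
sumBelow-⟦≡⟧ t (suc n) = trans (cong (_+_ ⟦ t ≡ n ⟧) (sumBelow-⟦≡⟧ t n)) (sym (⟦<⟧-suc t n))

preimages-below : ∀ w v n → sumBelow n (λ a → ⟦ v ≡ perm w a ⟧) ≡ ⟦ perm⁻¹ w v < n ⟧
preimages-below w v n = trans (sumBelow-cong n pointwise) (sumBelow-⟦≡⟧ (perm⁻¹ w v) n)
  where
  pointwise : ∀ a → ⟦ v ≡ perm w a ⟧ ≡ ⟦ perm⁻¹ w v ≡ a ⟧
  pointwise a with v ≟ perm w a
  ... | yes refl = trans (⟦≡⟧-yes (perm w a)) (sym (trans (cong ⟦_≡ a ⟧ (perm⁻¹-perm w a)) (⟦≡⟧-yes a)))
  ... | no v≢wa = trans (⟦≡⟧-no v≢wa) (sym (⟦≡⟧-no λ w⁻¹v≡a → v≢wa (trans (sym (perm-perm⁻¹ w v)) (cong (perm w) w⁻¹v≡a))))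

⟦<⟧-swap-same : ∀ k m → ⟦ k < swap k m ⟧ + ⟦ suc k ≡ m ⟧ ≡ ⟦ k < m ⟧ + ⟦ k ≡ m ⟧
⟦<⟧-swap-same k m with m ≟ k
... | yes refl rewrite ⟦<⟧-yes (n<1+n k) | ⟦≡⟧-no (1+n≢n {k}) | ⟦<⟧-no (≤-refl {k}) | ⟦≡⟧-yes k = refl
... | no m≢k with m ≟ suc k
...   | yes refl rewrite ⟦<⟧-no (≤-refl {k}) | ⟦≡⟧-yes (suc k) | ⟦<⟧-yes (n<1+n k) | ⟦≡⟧-no (<⇒≢ (n<1+n k)) = refl
...   | no m≢1+k rewrite ⟦≡⟧-no (m≢1+k ∘ sym) | ⟦≡⟧-no (m≢k ∘ sym) = refl

⟦<⟧-swap-other : ∀ {j k} m → j ≢ k → ⟦ k < swap j m ⟧ ≡ ⟦ k < m ⟧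
⟦<⟧-swap-other {j} {k} m j≢k with m ≟ j
... | yes refl rewrite ⟦<⟧-suc k j | ⟦≡⟧-no (j≢k ∘ sym) = refl
... | no m≢j with m ≟ suc j
...   | yes refl rewrite ⟦<⟧-suc k j | ⟦≡⟧-no (j≢k ∘ sym) = refl
...   | no m≢1+j = refl

cut : ℕ → (ℕ → ℕ) → ℕ
cut k g = sumBelow (suc k) (λ a → ⟦ k < g a ⟧)

cut-id : ∀ k → cut k (perm []) ≡ 0
cut-id k = below (suc k) ≤-refl
  where
  below : ∀ n → n ≤ suc k → sumBelow n (λ a → ⟦ k < a ⟧) ≡ 0
  below zero _ = refl
  below (suc n) (s≤s n≤k) = cong₂ _+_ (⟦<⟧-no n≤k) (below n (m≤n⇒m≤1+n n≤k))

cut-step-same : ∀ k w →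
  cut k (perm (k ∷ w)) + ⟦ perm⁻¹ w (suc k) < suc k ⟧ ≡ cut k (perm w) + ⟦ perm⁻¹ w k < suc k ⟧
cut-step-same k w = begin
  cut k (perm (k ∷ w)) + ⟦ perm⁻¹ w (suc k) < suc k ⟧
    ≡⟨ cong (_+_ (cut k (perm (k ∷ w)))) (preimages-below w (suc k) (suc k)) ⟨
  sumBelow (suc k) (λ a → ⟦ k < swap k (perm w a) ⟧) + sumBelow (suc k) (λ a → ⟦ suc k ≡ perm w a ⟧)
    ≡⟨ sumBelow-+ (λ a → ⟦ k < swap k (perm w a) ⟧) (λ a → ⟦ suc k ≡ perm w a ⟧) (suc k) ⟨
  sumBelow (suc k) (λ a → ⟦ k < swap k (perm w a) ⟧ + ⟦ suc k ≡ perm w a ⟧)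
    ≡⟨ sumBelow-cong (suc k) (λ a → ⟦<⟧-swap-same k (perm w a)) ⟩
  sumBelow (suc k) (λ a → ⟦ k < perm w a ⟧ + ⟦ k ≡ perm w a ⟧)
    ≡⟨ sumBelow-+ (λ a → ⟦ k < perm w a ⟧) (λ a → ⟦ k ≡ perm w a ⟧) (suc k) ⟩
  cut k (perm w) + sumBelow (suc k) (λ a → ⟦ k ≡ perm w a ⟧)
    ≡⟨ cong (_+_ (cut k (perm w))) (preimages-below w k (suc k)) ⟩
  cut k (perm w) + ⟦ perm⁻¹ w k < suc k ⟧ ∎
  where open ≡-Reasoning

cut-step-other : ∀ {j k} w → j ≢ k → cut k (perm (j ∷ w)) ≡ cut k (perm w)
cut-step-other {k = k} w j≢k = sumBelow-cong (suc k) (λ a → ⟦<⟧-swap-other (perm w a) j≢k)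

count-∷ : ∀ k j w → count k (j ∷ w) ≡ ⟦ j ≡ k ⟧ + count k w
count-∷ k j w with j ≟ k
... | yes refl = trans (cong length (filter-accept (_≟ k) refl)) (cong (_+ count k w) (sym (⟦≡⟧-yes k)))
... | no j≢k = trans (cong length (filter-reject (_≟ k) j≢k)) (cong (_+ count k w) (sym (⟦≡⟧-no j≢k)))

count-here : ∀ k w → count k (k ∷ w) ≡ suc (count k w)
count-here k w = trans (count-∷ k k w) (cong (_+ count k w) (⟦≡⟧-yes k))

count-++ : ∀ k u v → count k (u ++ v) ≡ count k u + count k v
count-++ k u v = trans (cong length (filter-++ (_≟ k) u v)) (length-++ (filter (_≟ k) u))

cut-step-≤ : ∀ k j w → cut k (perm (j ∷ w)) ≤ ⟦ j ≡ k ⟧ + cut k (perm w)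
cut-step-≤ k j w with j ≟ k
... | no j≢k = ≤-reflexive (trans (cut-step-other w j≢k) (cong (_+ cut k (perm w)) (sym (⟦≡⟧-no j≢k))))
... | yes refl = begin
  cut k (perm (k ∷ w))                                   ≤⟨ m≤m+n _ _ ⟩
  cut k (perm (k ∷ w)) + ⟦ perm⁻¹ w (suc k) < suc k ⟧    ≡⟨ cut-step-same k w ⟩
  cut k (perm w) + ⟦ perm⁻¹ w k < suc k ⟧               ≤⟨ +-monoʳ-≤ (cut k (perm w)) (⟦<⟧≤1 (perm⁻¹ w k) (suc k)) ⟩
  cut k (perm w) + 1                                     ≡⟨ +-comm (cut k (perm w)) 1 ⟩
  1 + cut k (perm w)                                     ≡⟨ cong (_+ cut k (perm w)) (⟦≡⟧-yes k) ⟨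
  ⟦ k ≡ k ⟧ + cut k (perm w)                             ∎
  where open ≤-Reasoning

cut-++-≤ : ∀ k u v → cut k (perm (u ++ v)) ≤ count k u + cut k (perm v)
cut-++-≤ k [] v = ≤-refl
cut-++-≤ k (j ∷ u) v = begin
  cut k (perm (j ∷ u ++ v))             ≤⟨ cut-step-≤ k j (u ++ v) ⟩
  ⟦ j ≡ k ⟧ + cut k (perm (u ++ v))     ≤⟨ +-monoʳ-≤ ⟦ j ≡ k ⟧ (cut-++-≤ k u v) ⟩
  ⟦ j ≡ k ⟧ + (count k u + cut k (perm v)) ≡⟨ +-assoc ⟦ j ≡ k ⟧ (count k u) _ ⟨
  ⟦ j ≡ k ⟧ + count k u + cut k (perm v) ≡⟨ cong (_+ cut k (perm v)) (count-∷ k j u) ⟨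
  count k (j ∷ u) + cut k (perm v)      ∎
  where open ≤-Reasoning

cut≤count : ∀ k w → cut k (perm w) ≤ count k w
cut≤count k w = begin
  cut k (perm w)               ≡⟨ cong (cut k ∘ perm) (++-identityʳ w) ⟨
  cut k (perm (w ++ []))       ≤⟨ cut-++-≤ k w [] ⟩
  count k w + cut k (perm [])  ≡⟨ cong (_+_ (count k w)) (cut-id k) ⟩
  count k w + 0                ≡⟨ +-identityʳ (count k w) ⟩
  count k w                    ∎
  where open ≤-Reasoning

crosses⇒cut-step : ∀ k w → Crosses k w → cut k (perm (k ∷ w)) ≡ suc (cut k (perm w))
crosses⇒cut-step k w (w⁻¹k≤k , k<w⁻¹[1+k]) = begin
  cut k (perm (k ∷ w))                                  ≡⟨ +-identityʳ _ ⟨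
  cut k (perm (k ∷ w)) + 0                              ≡⟨ cong (_+_ (cut k (perm (k ∷ w)))) (⟦<⟧-no k<w⁻¹[1+k]) ⟨
  cut k (perm (k ∷ w)) + ⟦ perm⁻¹ w (suc k) < suc k ⟧   ≡⟨ cut-step-same k w ⟩
  cut k (perm w) + ⟦ perm⁻¹ w k < suc k ⟧              ≡⟨ cong (_+_ (cut k (perm w))) (⟦<⟧-yes (s≤s w⁻¹k≤k)) ⟩
  cut k (perm w) + 1                                    ≡⟨ +-comm (cut k (perm w)) 1 ⟩
  suc (cut k (perm w))                                  ∎
  where open ≡-Reasoning

cut-step⇒crosses : ∀ k w → suc (cut k (perm w)) ≤ cut k (perm (k ∷ w)) → Crosses k w
cut-step⇒crosses k w step = ≤-pred (⟦<⟧-pos (≤-trans (s≤s z≤n) 1+p≤q)) , ⟦<⟧-zero p≡0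
  where
  c p q : ℕ
  c = cut k (perm w)
  p = ⟦ perm⁻¹ w (suc k) < suc k ⟧
  q = ⟦ perm⁻¹ w k < suc k ⟧
  1+p≤q : suc p ≤ q
  1+p≤q = +-cancelˡ-≤ c _ _ (begin
    c + suc p                        ≡⟨ +-suc c p ⟩
    suc c + p                        ≤⟨ +-monoˡ-≤ p step ⟩
    cut k (perm (k ∷ w)) + p         ≡⟨ cut-step-same k w ⟩
    c + q                            ∎)
    where open ≤-Reasoning
  p≡0 : p ≡ 0
  p≡0 = n≤0⇒n≡0 (≤-pred (≤-trans 1+p≤q (⟦<⟧≤1 (perm⁻¹ w k) (suc k))))

Tight : ℕ → Word → Set
Tight k w = count k w ≤ cut k (perm w)

tight-++ʳ : ∀ {k} u {v} → Tight k (u ++ v) → Tight k v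
tight-++ʳ {k} u {v} tight = +-cancelˡ-≤ (count k u) _ _ (begin
  count k u + count k v         ≡⟨ count-++ k u v ⟨
  count k (u ++ v)              ≤⟨ tight ⟩
  cut k (perm (u ++ v))         ≤⟨ cut-++-≤ k u v ⟩
  count k u + cut k (perm v)    ∎)
  where open ≤-Reasoning

tight⇒crosses : ∀ k w → Tight k (k ∷ w) → Crosses k w
tight⇒crosses k w tight = cut-step⇒crosses k w (begin
  suc (cut k (perm w))      ≤⟨ s≤s (cut≤count k w) ⟩
  suc (count k w)           ≡⟨ count-here k w ⟨
  count k (k ∷ w)           ≤⟨ tight ⟩
  cut k (perm (k ∷ w))      ∎)
  where open ≤-Reasoning

lettersCross⇒tight : ∀ {w} → LettersCross w → ∀ k → Tight k w
lettersCross⇒tight {[]} _ k = z≤n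
lettersCross⇒tight {j ∷ w} (crosses , rest) k with j ≟ k
... | yes refl = begin
  count j (j ∷ w)            ≡⟨ count-here j w ⟩
  suc (count j w)            ≤⟨ s≤s (lettersCross⇒tight rest j) ⟩
  suc (cut j (perm w))       ≡⟨ crosses⇒cut-step j w crosses ⟨
  cut j (perm (j ∷ w))       ∎
  where open ≤-Reasoning
... | no j≢k = begin
  count k (j ∷ w)            ≡⟨ count-∷ k j w ⟩
  ⟦ j ≡ k ⟧ + count k w      ≡⟨ cong (_+ count k w) (⟦≡⟧-no j≢k) ⟩
  count k w                  ≤⟨ lettersCross⇒tight rest k ⟩
  cut k (perm w)             ≡⟨ cut-step-other w j≢k ⟨
  cut k (perm (j ∷ w))       ∎
  where open ≤-Reasoning

crosses-braid : ∀ {i j} b → j ≡ suc i ⊎ i ≡ suc j → Crosses i (j ∷ i ∷ b) → ¬ Crosses i b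
crosses-braid {i} b (inj₁ refl) (above , _) (_ , below) = <⇒≱ below (subst (_≤ i) route above)
  where
  route : perm⁻¹ (suc i ∷ i ∷ b) i ≡ perm⁻¹ b (suc i)
  route = trans (cong (perm⁻¹ b ∘ swap i) (swap-fixes (<⇒≢ (n<1+n i)) (<⇒≢ (m<n⇒m<1+n (n<1+n i)))))
                (cong (perm⁻¹ b) (swap-left i))
crosses-braid {j = j} b (inj₂ refl) (_ , below) (above , _) = <⇒≱ (subst (suc j <_) route below) above
  where
  route : perm⁻¹ (j ∷ suc j ∷ b) (suc (suc j)) ≡ perm⁻¹ b (suc j)
  route = trans (cong (perm⁻¹ b ∘ swap (suc j)) (swap-fixes (<⇒≢ (m<n⇒m<1+n (n<1+n j)) ∘ sym) 1+n≢n))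
                (cong (perm⁻¹ b) (swap-right (suc j)))

tight-braid-free : ∀ {i j} a b → j ≡ suc i ⊎ i ≡ suc j → ¬ Tight i (a ++ i ∷ j ∷ i ∷ b)
tight-braid-free {i} {j} a b adjacent tight =
  crosses-braid b adjacent (tight⇒crosses i (j ∷ i ∷ b) suffix) (tight⇒crosses i b (tight-++ʳ (i ∷ j ∷ []) suffix))
  where
  suffix : Tight i (i ∷ j ∷ i ∷ b)
  suffix = tight-++ʳ a tight

-- Reduced words

length≡sum-count : ∀ {N} w → ValidWord N w → length w ≡ sumBelow N (λ k → count k w)
length≡sum-count {N} [] [] = sym (sumBelow-0 N)
length≡sum-count {N} (j ∷ w) ((_ , j<N) ∷ valid) = begin
  suc (length w)                                              ≡⟨ cong suc (length≡sum-count w valid) ⟩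
  1 + sumBelow N (λ k → count k w)                            ≡⟨ cong (_+ sumBelow N (λ k → count k w)) (⟦<⟧-yes j<N) ⟨
  ⟦ j < N ⟧ + sumBelow N (λ k → count k w)                    ≡⟨ cong (_+ sumBelow N (λ k → count k w)) (sumBelow-⟦≡⟧ j N) ⟨
  sumBelow N (λ k → ⟦ j ≡ k ⟧) + sumBelow N (λ k → count k w) ≡⟨ sumBelow-+ (λ k → ⟦ j ≡ k ⟧) (λ k → count k w) N ⟨
  sumBelow N (λ k → ⟦ j ≡ k ⟧ + count k w)                    ≡⟨ sumBelow-cong N (λ k → count-∷ k j w) ⟨
  sumBelow N (λ k → count k (j ∷ w))                          ∎
  where open ≡-Reasoning

count-out-of-range : ∀ {N k} w → ValidWord N w → N ≤ k → count k w ≡ 0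
count-out-of-range [] [] _ = refl
count-out-of-range {k = k} (j ∷ w) ((_ , j<N) ∷ valid) N≤k = begin
  count k (j ∷ w)          ≡⟨ count-∷ k j w ⟩
  ⟦ j ≡ k ⟧ + count k w    ≡⟨ cong₂ _+_ (⟦≡⟧-no (<⇒≢ (<-≤-trans j<N N≤k))) (count-out-of-range w valid N≤k) ⟩
  0                        ∎
  where open ≡-Reasoning

cut-≈ : ∀ k w w' → w' ≈w w → cut k (perm w') ≡ cut k (perm w)
cut-≈ k w w' w'≈w = sumBelow-cong (suc k) (λ a → cong ⟦ k <_⟧ (w'≈w a))

module _ {N w} (valid : ValidWord N w) (cross : LettersCross w) where

  private
    tight : ∀ k → Tight k w
    tight = lettersCross⇒tight cross

    Σcount : Word → ℕ
    Σcount v = sumBelow N (λ k → count k v)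

    Σcut : Word → ℕ
    Σcut v = sumBelow N (λ k → cut k (perm v))

    length≤Σcut : ∀ w' → w' ≈w w → length w ≤ Σcut w'
    length≤Σcut w' w'≈w = begin
      length w      ≡⟨ length≡sum-count w valid ⟩
      Σcount w      ≤⟨ sumBelow-mono N tight ⟩
      Σcut w        ≡⟨ sumBelow-cong N (λ k → cut-≈ k w w' w'≈w) ⟨
      Σcut w'       ∎
      where open ≤-Reasoning

  reduced : Reduced N w
  reduced w' valid' w'≈w = begin
    length w      ≤⟨ length≤Σcut w' w'≈w ⟩
    Σcut w'       ≤⟨ sumBelow-mono N (λ k → cut≤count k w') ⟩
    Σcount w'     ≡⟨ length≡sum-count w' valid' ⟨
    length w'     ∎
    where open ≤-Reasoning

  reduced-tight : ∀ w' → ValidWord N w' → w' ≈w w → Reduced N w' → ∀ k → Tight k w'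
  reduced-tight w' valid' w'≈w red' k with k <? N
  ... | no k≮N = ≤-trans (≤-reflexive (count-out-of-range w' valid' (≮⇒≥ k≮N))) z≤n
  ... | yes k<N = sumBelow-tight N (λ k → cut≤count k w') Σcount≤Σcut k<N
    where
    Σcount≤Σcut : Σcount w' ≤ Σcut w'
    Σcount≤Σcut = begin
      Σcount w'     ≡⟨ length≡sum-count w' valid' ⟨
      length w'     ≤⟨ red' w valid (sym ∘ w'≈w) ⟩
      length w      ≤⟨ length≤Σcut w' w'≈w ⟩
      Σcut w'       ∎
      where open ≤-Reasoning

  avoids321 : Avoids321 N w
  avoids321 w' valid' w'≈w red' (a , b , i , j , adjacent , refl) =
    tight-braid-free a b adjacent (reduced-tight w' valid' w'≈w red' i)

  reduced-count-≤ : ∀ w' → ValidWord N w' → w' ≈w w → Reduced N w' → ∀ k → count k w' ≤ count k w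
  reduced-count-≤ w' valid' w'≈w red' k = begin
    count k w'        ≤⟨ reduced-tight w' valid' w'≈w red' k ⟩
    cut k (perm w')   ≡⟨ cut-≈ k w w' w'≈w ⟩
    cut k (perm w)    ≤⟨ cut≤count k w ⟩
    count k w         ∎
    where open ≤-Reasoning

-- Rows, parity and reading order

<⇒≡+suc : ∀ {x z} → x ℤ.< z → ∃[ n ] z ≡ x ℤ.+ + suc n
<⇒≡+suc {x} {z} x<z = ∣ z ℤ.- (+ 1 ℤ.+ x) ∣ , (begin
  z                                      ≡⟨ shift x z ⟩
  x ℤ.+ (+ 1 ℤ.+ (z ℤ.- (+ 1 ℤ.+ x)))    ≡⟨ cong (λ d → x ℤ.+ (+ 1 ℤ.+ d)) (ℤₚ.0≤i⇒+∣i∣≡i (ℤₚ.i≤j⇒0≤j-i (ℤₚ.i<j⇒suc[i]≤j x<z))) ⟨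
  x ℤ.+ + suc ∣ z ℤ.- (+ 1 ℤ.+ x) ∣      ∎)
  where
  open ≡-Reasoning
  shift : ∀ x z → z ≡ x ℤ.+ (+ 1 ℤ.+ (z ℤ.- (+ 1 ℤ.+ x)))
  shift = solve-∀

<∧<+2⇒≡+1 : ∀ {x z} → x ℤ.< z → z ℤ.< x ℤ.+ + 2 → z ≡ x ℤ.+ + 1
<∧<+2⇒≡+1 {x} x<z z<x+2 with <⇒≡+suc x<z
... | zero , refl = refl
... | suc n , refl = ⊥-elim (ℤₚ.<⇒≱ z<x+2 (ℤₚ.+-monoʳ-≤ x (+≤+ {2} {suc (suc n)} (s≤s (s≤s z≤n)))))

<∧∣-∣≡2⇒≡+2 : ∀ {x z} → x ℤ.< z → ∣ x ℤ.- z ∣ ≡ 2 → z ≡ x ℤ.+ + 2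
<∧∣-∣≡2⇒≡+2 {x} x<z ∣x-z∣≡2 with <⇒≡+suc x<z
... | n , refl = cong (λ m → x ℤ.+ + m) (trans (cong ∣_∣ (sym (x-[x+t]≡-t x (+ suc n)))) ∣x-z∣≡2)
  where
  x-[x+t]≡-t : ∀ x t → x ℤ.- (x ℤ.+ t) ≡ ℤ.- t
  x-[x+t]≡-t = solve-∀

even-odd : ∀ {i} → + 2 ∣ℤ i → + 2 ∣ℤ (i ℤ.+ + 1) → ⊥
even-odd {i} 2∣i 2∣i+1 with ∣⇒≤ (∣⇒∣ᵤ (∣m+n∣m⇒∣n {+ 2} {i} {+ 1} (∣ᵤ⇒∣ 2∣i+1) (∣ᵤ⇒∣ 2∣i)))
... | s≤s ()

letter-row : ∀ {p} → InT p → + letter p ≡ + 1 ℤ.- yc p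
letter-row {_ , + zero} _ = refl
letter-row {_ , -[1+ n ]} _ = refl
letter-row {_ , + suc n} (+≤+ () , _)

same-letter⇒same-row : ∀ p q → InT p → InT q → letter p ≡ letter q → yc p ≡ yc q
same-letter⇒same-row p q p∈T q∈T same = begin
  yc p                      ≡⟨ 1-[1-y]≡y (yc p) ⟨
  + 1 ℤ.- (+ 1 ℤ.- yc p)    ≡⟨ cong (λ t → + 1 ℤ.- t) (trans (sym (letter-row {p} p∈T)) (trans (cong +_ same) (letter-row {q} q∈T))) ⟩
  + 1 ℤ.- (+ 1 ℤ.- yc q)    ≡⟨ 1-[1-y]≡y (yc q) ⟩
  yc q                      ∎
  where
  open ≡-Reasoning
  1-[1-y]≡y : ∀ y → + 1 ℤ.- (+ 1 ℤ.- y) ≡ y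
  1-[1-y]≡y = solve-∀

parity-clash : ∀ p q → InT p → InT q → xc q ℤ.- yc q ≡ (xc p ℤ.- yc p) ℤ.+ + 1 → ⊥
parity-clash p q (_ , _ , 2∣p) (_ , _ , 2∣q) q≡p+1 = even-odd {xc p ℤ.- yc p} 2∣p (subst (+ 2 ∣ℤ_) q≡p+1 2∣q)

≺-asym : ∀ {p q} → p ≺ q → ¬ q ≺ p
≺-asym (inj₁ xp<xq) (inj₁ xq<xp) = ℤₚ.<-asym xp<xq xq<xp
≺-asym (inj₁ xp<xq) (inj₂ (xq≡xp , _)) = ℤₚ.<-irrefl (sym xq≡xp) xp<xq
≺-asym (inj₂ (xp≡xq , _)) (inj₁ xq<xp) = ℤₚ.<-irrefl (sym xp≡xq) xq<xp
≺-asym (inj₂ (_ , yq<yp)) (inj₂ (_ , yp<yq)) = ℤₚ.<-asym yq<yp yp<yq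

≺-irrefl : ∀ {p} → ¬ p ≺ p
≺-irrefl p≺p = ≺-asym p≺p p≺p

≺⇒≢ : ∀ {p q} → p ≺ q → p ≢ q
≺⇒≢ p≺q refl = ≺-irrefl p≺q

northeast southeast east : Point → Point
northeast p = (xc p ℤ.+ + 1 , yc p ℤ.+ + 1)
southeast p = (xc p ℤ.+ + 1 , yc p ℤ.- + 1)
east p = (xc p ℤ.+ + 2 , yc p)

private
  +-step : ∀ x {m n} → m < n → x ℤ.+ + m ℤ.< x ℤ.+ + n
  +-step x m<n = ℤₚ.+-monoʳ-< x (+<+ m<n)

  <+1 : ∀ x → x ℤ.< x ℤ.+ + 1
  <+1 x = subst (ℤ._< x ℤ.+ + 1) (ℤₚ.+-identityʳ x) (+-step x (s≤s z≤n))

  <+2 : ∀ x → x ℤ.< x ℤ.+ + 2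
  <+2 x = subst (ℤ._< x ℤ.+ + 2) (ℤₚ.+-identityʳ x) (+-step x (s≤s z≤n))

≺-northeast : ∀ p → p ≺ northeast p
≺-northeast p = inj₁ (<+1 (xc p))

≺-southeast : ∀ p → p ≺ southeast p
≺-southeast p = inj₁ (<+1 (xc p))

northeast-≺-east : ∀ p → northeast p ≺ east p
northeast-≺-east p = inj₁ (+-step (xc p) (s≤s (s≤s z≤n)))

southeast-≺-east : ∀ p → southeast p ≺ east p
southeast-≺-east p = inj₁ (+-step (xc p) (s≤s (s≤s z≤n)))

northeast-unique : ∀ {p z} → InT p → InT z → p ≺ z → z ≺ east p → yc z ≡ yc p ℤ.+ + 1 → z ≡ northeast p
northeast-unique {p} {z} p∈T z∈T p≺z z≺east row = cong₂ _,_ (<∧<+2⇒≡+1 (right-of-p p≺z) (left-of-east z≺east)) row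
  where
  right-of-p : p ≺ z → xc p ℤ.< xc z
  right-of-p (inj₁ xp<xz) = xp<xz
  right-of-p (inj₂ (_ , yz<yp)) = ⊥-elim (ℤₚ.<-asym yz<yp (subst (yc p ℤ.<_) (sym row) (<+1 (yc p))))
  left-of-east : z ≺ east p → xc z ℤ.< xc p ℤ.+ + 2
  left-of-east (inj₁ xz<xe) = xz<xe
  left-of-east (inj₂ (xz≡xe , _)) = ⊥-elim (parity-clash p z p∈T z∈T (trans (cong₂ ℤ._-_ xz≡xe row) (shift (xc p) (yc p))))
    where
    shift : ∀ x y → (x ℤ.+ + 2) ℤ.- (y ℤ.+ + 1) ≡ (x ℤ.- y) ℤ.+ + 1
    shift = solve-∀

southeast-unique : ∀ {p z} → InT p → InT z → p ≺ z → z ≺ east p → yc z ≡ yc p ℤ.- + 1 → z ≡ southeast p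
southeast-unique {p} {z} p∈T z∈T p≺z z≺east row = cong₂ _,_ (<∧<+2⇒≡+1 (right-of-p p≺z) (left-of-east z≺east)) row
  where
  right-of-p : p ≺ z → xc p ℤ.< xc z
  right-of-p (inj₁ xp<xz) = xp<xz
  right-of-p (inj₂ (xp≡xz , _)) = ⊥-elim (parity-clash p z p∈T z∈T (trans (cong₂ ℤ._-_ (sym xp≡xz) row) (shift (xc p) (yc p))))
    where
    shift : ∀ x y → x ℤ.- (y ℤ.- + 1) ≡ (x ℤ.- y) ℤ.+ + 1
    shift = solve-∀
  left-of-east : z ≺ east p → xc z ℤ.< xc p ℤ.+ + 2
  left-of-east (inj₁ xz<xe) = xz<xe
  left-of-east (inj₂ (_ , yp<yz)) = ⊥-elim (ℤₚ.<-asym yp<yz (subst (ℤ._< yc p) (sym row) (-1+ (yc p))))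
    where
    -1+ : ∀ y → y ℤ.- + 1 ℤ.< y
    -1+ y = subst (y ℤ.- + 1 ℤ.<_) (ℤₚ.+-identityʳ y) (ℤₚ.+-monoʳ-< y -<+)

letter-northeast : ∀ p → InT p → InT (northeast p) → suc (letter (northeast p)) ≡ letter p
letter-northeast p p∈T ne∈T = ℤₚ.+-injective (begin
  + 1 ℤ.+ + letter (northeast p)         ≡⟨ cong (λ t → + 1 ℤ.+ t) (letter-row {northeast p} ne∈T) ⟩
  + 1 ℤ.+ (+ 1 ℤ.- (yc p ℤ.+ + 1))       ≡⟨ shift (yc p) ⟩
  + 1 ℤ.- yc p                           ≡⟨ letter-row {p} p∈T ⟨
  + letter p                             ∎)
  where
  open ≡-Reasoning
  shift : ∀ y → + 1 ℤ.+ (+ 1 ℤ.- (y ℤ.+ + 1)) ≡ + 1 ℤ.- y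
  shift = solve-∀

letter-southeast : ∀ p → InT p → InT (southeast p) → letter (southeast p) ≡ suc (letter p)
letter-southeast p p∈T se∈T = ℤₚ.+-injective (begin
  + letter (southeast p)                 ≡⟨ letter-row {southeast p} se∈T ⟩
  + 1 ℤ.- (yc p ℤ.- + 1)                 ≡⟨ shift (yc p) ⟩
  + 1 ℤ.+ (+ 1 ℤ.- yc p)                 ≡⟨ cong (λ t → + 1 ℤ.+ t) (letter-row {p} p∈T) ⟨
  + 1 ℤ.+ + letter p                     ∎)
  where
  open ≡-Reasoning
  shift : ∀ y → + 1 ℤ.- (y ℤ.- + 1) ≡ + 1 ℤ.+ (+ 1 ℤ.- y)
  shift = solve-∀

module _ {a r} {A : Set a} {_<_ : Rel A r} where

  allPairs-++⁻ : ∀ xs {ys} → AllPairs _<_ (xs ++ ys) →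
    AllPairs _<_ xs × All (λ x → All (x <_) ys) xs × AllPairs _<_ ys
  allPairs-++⁻ [] sorted = [] , [] , sorted
  allPairs-++⁻ (x ∷ xs) (x<xs++ys ∷ sorted) with allPairs-++⁻ xs sorted
  ... | sorted-xs , xs<ys , sorted-ys = Allₚ.++⁻ˡ xs x<xs++ys ∷ sorted-xs , Allₚ.++⁻ʳ xs x<xs++ys ∷ xs<ys , sorted-ys

  split-sorted : ∀ {x xs} → AllPairs _<_ xs → x ∈ xs →
    ∃₂ λ ys zs → xs ≡ ys ++ x ∷ zs × All (_< x) ys × All (x <_) zs
  split-sorted sorted x∈xs with ∈-∃++ x∈xs
  ... | ys , zs , refl with allPairs-++⁻ ys sorted
  ...   | _ , ys<x∷zs , (x<zs ∷ _) = ys , zs , refl , All.map All.head ys<x∷zs , x<zs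

  module _ (asym : Asymmetric _<_) {x z : A} {zs : List A} where

    ∈-after : ∀ ys → All (_< x) ys → z ∈ ys ++ x ∷ zs → x < z → z ∈ zs
    ∈-after ys ys<x z∈ x<z with ∈-++⁻ ys z∈
    ... | inj₁ z∈ys = ⊥-elim (asym (All.lookup ys<x z∈ys) x<z)
    ... | inj₂ (here refl) = ⊥-elim (asym x<z x<z)
    ... | inj₂ (there z∈zs) = z∈zs

    ∈-before : ∀ ys → All (x <_) zs → z ∈ ys ++ x ∷ zs → z < x → z ∈ ys
    ∈-before ys x<zs z∈ z<x with ∈-++⁻ ys z∈
    ... | inj₁ z∈ys = z∈ys
    ... | inj₂ (here refl) = ⊥-elim (asym z<x z<x)
    ... | inj₂ (there z∈zs) = ⊥-elim (asym (All.lookup x<zs z∈zs) z<x)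

map-++-++ : ∀ {A B : Set} (f : A → B) xs a ys b zs →
  map f ((xs ++ a ∷ ys) ++ b ∷ zs) ≡ (map f xs ++ f a ∷ map f ys) ++ f b ∷ map f zs
map-++-++ f xs a ys b zs = trans (map-++ f (xs ++ a ∷ ys) (b ∷ zs)) (cong (_++ f b ∷ map f zs) (map-++ f xs (a ∷ ys)))

count-map : ∀ {A : Set} i (f : A → ℕ) xs → count i (map f xs) ≡ length (filter (λ x → f x ≟ i) xs)
count-map i f [] = refl
count-map i f (x ∷ xs) with f x ≟ i
... | yes fx≡i = trans (cong length (filter-accept (_≟ i) fx≡i))
                       (trans (cong suc (count-map i f xs)) (sym (cong length (filter-accept (λ y → f y ≟ i) {x} fx≡i))))
... | no fx≢i = trans (cong length (filter-reject (_≟ i) fx≢i))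
                      (trans (count-map i f xs) (sym (cong length (filter-reject (λ y → f y ≟ i) {x} fx≢i))))

-- Admissible configurations

module Configuration {C : List Point} (C⊆T : All InT C) (sorted : AllPairs _≺_ C) (adm : Admissible C) where

  private
    no-three-in-a-row : ∀ {p q r} → p ∈ C → q ∈ C → r ∈ C → p ≢ q → q ≢ r → p ≢ r →
      ¬ (yc p ≡ yc q × yc q ≡ yc r)
    no-three-in-a-row = proj₁ adm

    gap-two : ∀ {p q} → p ∈ C → q ∈ C → p ≢ q → yc p ≡ yc q → ∣ xc p ℤ.- xc q ∣ ≡ 2
    gap-two = proj₁ (proj₂ adm)

    closure : ∀ {p q} → p ∈ C → q ∈ C → yc p ≡ yc q → xc p ℤ.< xc q → northeast p ∈ C × southeast p ∈ C
    closure = proj₂ (proj₂ adm)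

    ∈T : ∀ {p} → p ∈ C → InT p
    ∈T = All.lookup C⊆T

  east-unique : ∀ {p z} → p ∈ C → z ∈ C → p ≺ z → yc z ≡ yc p → z ≡ east p
  east-unique {p} {z} p∈C z∈C p≺z row =
    cong₂ _,_ (<∧∣-∣≡2⇒≡+2 (right-of-p p≺z) (gap-two p∈C z∈C (≺⇒≢ p≺z) (sym row))) row
    where
    right-of-p : p ≺ z → xc p ℤ.< xc z
    right-of-p (inj₁ xp<xz) = xp<xz
    right-of-p (inj₂ (_ , yz<yp)) = ⊥-elim (ℤₚ.<-irrefl row yz<yp)

  module _ {p} (p∈C : p ∈ C) where

    Between : Point → Set
    Between z = (p ≺ z × z ∈ C) × z ≺ east p

    letter≢ : ∀ {z} → p ≺ z → z ∈ C → z ≢ east p → letter z ≢ letter p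
    letter≢ {z} p≺z z∈C z≢east same = z≢east (east-unique p∈C z∈C p≺z (same-letter⇒same-row z p (∈T z∈C) (∈T p∈C) same))

    letter≢northeast : ∀ {z} → northeast p ∈ C → Between z → z ≢ northeast p → letter z ≢ letter (northeast p)
    letter≢northeast {z} ne∈C ((p≺z , z∈C) , z≺east) z≢ne same =
      z≢ne (northeast-unique (∈T p∈C) (∈T z∈C) p≺z z≺east (same-letter⇒same-row z (northeast p) (∈T z∈C) (∈T ne∈C) same))

    letter≢southeast : ∀ {z} → southeast p ∈ C → Between z → z ≢ southeast p → letter z ≢ letter (southeast p)
    letter≢southeast {z} se∈C ((p≺z , z∈C) , z≺east) z≢se same =
      z≢se (southeast-unique (∈T p∈C) (∈T z∈C) p≺z z≺east (same-letter⇒same-row z (southeast p) (∈T z∈C) (∈T se∈C) same))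

    crosses₁-of-northeast : ∀ mid rest → northeast p ∈ C → northeast p ∈ mid → All Between mid → AllPairs _≺_ mid →
      All (_≢ letter p) (map letter rest) → perm⁻¹ (map letter (mid ++ east p ∷ rest)) (letter p) ≤ letter p
    crosses₁-of-northeast mid rest ne∈C ne∈mid between sorted-mid rest≢k with split-sorted sorted-mid ne∈mid
    ... | u₁ , u₂ , refl , u₁≺ne , ne≺u₂ =
      subst (λ w → perm⁻¹ w (letter p) ≤ letter p) (sym (map-++-++ letter u₁ (northeast p) u₂ (east p) rest))
        (crosses₁-of-pattern (map letter u₁) (map letter u₂) (map letter rest)
          (letter-northeast p (∈T p∈C) (∈T ne∈C)) u₁≢ne u₁≢k u₂≢ne rest≢k)
      where
      u₁≢ne : All (_≢ letter (northeast p)) (map letter u₁)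
      u₁≢ne = Allₚ.map⁺ (All.zipWith (λ (z-between , z≺ne) → letter≢northeast ne∈C z-between (≺⇒≢ z≺ne))
                                    (Allₚ.++⁻ˡ u₁ between , u₁≺ne))
      u₁≢k : All (_≢ letter p) (map letter u₁)
      u₁≢k = Allₚ.map⁺ (All.map (λ ((p≺z , z∈C) , z≺east) → letter≢ p≺z z∈C (≺⇒≢ z≺east)) (Allₚ.++⁻ˡ u₁ between))
      u₂≢ne : All (_≢ letter (northeast p)) (map letter u₂)
      u₂≢ne = Allₚ.map⁺ (All.zipWith (λ (z-between , ne≺z) → letter≢northeast ne∈C z-between (≺⇒≢ ne≺z ∘ sym))
                                    (All.tail (Allₚ.++⁻ʳ u₁ between) , ne≺u₂))

    crosses₂-of-southeast : ∀ mid rest → southeast p ∈ C → southeast p ∈ mid → All Between mid → AllPairs _≺_ mid →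
      All (_≢ letter p) (map letter rest) → letter p < perm⁻¹ (map letter (mid ++ east p ∷ rest)) (suc (letter p))
    crosses₂-of-southeast mid rest se∈C se∈mid between sorted-mid rest≢k with split-sorted sorted-mid se∈mid
    ... | l₁ , l₂ , refl , l₁≺se , se≺l₂ =
      subst (λ w → letter p < perm⁻¹ w (suc (letter p))) (sym (map-++-++ letter l₁ (southeast p) l₂ (east p) rest))
        (crosses₂-of-pattern (map letter l₁) (map letter l₂) (map letter rest)
          (letter-southeast p (∈T p∈C) (∈T se∈C)) l₁≢k l₁≢se l₂≢se rest≢k)
      where
      l₁≢se : All (_≢ letter (southeast p)) (map letter l₁)
      l₁≢se = Allₚ.map⁺ (All.zipWith (λ (z-between , z≺se) → letter≢southeast se∈C z-between (≺⇒≢ z≺se))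
                                    (Allₚ.++⁻ˡ l₁ between , l₁≺se))
      l₁≢k : All (_≢ letter p) (map letter l₁)
      l₁≢k = Allₚ.map⁺ (All.map (λ ((p≺z , z∈C) , z≺east) → letter≢ p≺z z∈C (≺⇒≢ z≺east)) (Allₚ.++⁻ˡ l₁ between))
      l₂≢se : All (_≢ letter (southeast p)) (map letter l₂)
      l₂≢se = Allₚ.map⁺ (All.zipWith (λ (z-between , se≺z) → letter≢southeast se∈C z-between (≺⇒≢ se≺z ∘ sym))
                                    (All.tail (Allₚ.++⁻ʳ l₁ between) , se≺l₂))

    crosses-of-successors : ∀ R → All (λ z → p ≺ z × z ∈ C) R → AllPairs _≺_ R →
      (∀ {z} → z ∈ C → p ≺ z → z ∈ R) → Crosses (letter p) (map letter R)
    crosses-of-successors R later sorted-R successor with east p ∈? R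
    ... | no east∉R = crosses-of-avoiding (map letter R) (Allₚ.map⁺ (All.tabulate λ {z} z∈R →
          let (p≺z , z∈C) = All.lookup later z∈R in letter≢ p≺z z∈C (λ z≡east → east∉R (subst (_∈ R) z≡east z∈R))))
    ... | yes east∈R with split-sorted sorted-R east∈R
    ...   | mid , rest , refl , mid≺east , east≺rest =
      crosses₁-of-northeast mid rest ne∈C (on-the-way ne∈C (≺-northeast p) (northeast-≺-east p)) between sorted-mid rest≢k ,
      crosses₂-of-southeast mid rest se∈C (on-the-way se∈C (≺-southeast p) (southeast-≺-east p)) between sorted-mid rest≢k
      where
      neighbours : northeast p ∈ C × southeast p ∈ C
      neighbours = closure p∈C (proj₂ (All.head (Allₚ.++⁻ʳ mid later))) refl (<+2 (xc p))
      ne∈C : northeast p ∈ C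
      ne∈C = proj₁ neighbours
      se∈C : southeast p ∈ C
      se∈C = proj₂ neighbours
      on-the-way : ∀ {z} → z ∈ C → p ≺ z → z ≺ east p → z ∈ mid
      on-the-way z∈C p≺z z≺east = ∈-before ≺-asym mid east≺rest (successor z∈C p≺z) z≺east
      between : All Between mid
      between = All.zip (Allₚ.++⁻ˡ mid later , mid≺east)
      sorted-mid : AllPairs _≺_ mid
      sorted-mid = proj₁ (allPairs-++⁻ mid sorted-R)
      rest≢k : All (_≢ letter p) (map letter rest)
      rest≢k = Allₚ.map⁺ (All.zipWith (λ ((p≺z , z∈C) , east≺z) → letter≢ p≺z z∈C (≺⇒≢ east≺z ∘ sym))
                                     (All.tail (Allₚ.++⁻ʳ mid later) , east≺rest))

  crosses-after : ∀ pre {p R} → C ≡ pre ++ p ∷ R → Crosses (letter p) (map letter R)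
  crosses-after pre {p} {R} C≡ with allPairs-++⁻ pre (subst (AllPairs _≺_) C≡ sorted)
  ... | _ , pre≺p∷R , (p≺R ∷ sorted-R) = crosses-of-successors p∈C R later sorted-R successor
    where
    in-C : ∀ {z} → z ∈ pre ++ p ∷ R → z ∈ C
    in-C = subst (_ ∈_) (sym C≡)
    p∈C : p ∈ C
    p∈C = in-C (∈-++⁺ʳ pre (here refl))
    later : All (λ z → p ≺ z × z ∈ C) R
    later = All.tabulate λ z∈R → All.lookup p≺R z∈R , in-C (∈-++⁺ʳ pre (there z∈R))
    successor : ∀ {z} → z ∈ C → p ≺ z → z ∈ R
    successor z∈C = ∈-after ≺-asym pre (All.map All.head pre≺p∷R) (subst (_ ∈_) C≡ z∈C)

  lettersCross : LettersCross (map letter C)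
  lettersCross = suffixes [] C refl
    where
    suffixes : ∀ pre R → C ≡ pre ++ R → LettersCross (map letter R)
    suffixes pre [] _ = _
    suffixes pre (p ∷ R) C≡ = crosses-after pre C≡ , suffixes (pre ++ p ∷ []) R (trans C≡ (sym (++-assoc pre (p ∷ []) R)))

  at-most-two-per-letter : ∀ i → count i (map letter C) ≤ 2
  at-most-two-per-letter i = subst (_≤ 2) (sym (count-map i letter C))
    (bound (filter has-letter? C) (filter⁺ has-letter? sorted) (∈-filter⁻ has-letter?))
    where
    has-letter? : ∀ z → Dec (letter z ≡ i)
    has-letter? z = letter z ≟ i
    row : ∀ {z z'} → z ∈ C × letter z ≡ i → z' ∈ C × letter z' ≡ i → yc z ≡ yc z'
    row {z} {z'} (z∈C , z↦i) (z'∈C , z'↦i) = same-letter⇒same-row z z' (∈T z∈C) (∈T z'∈C) (trans z↦i (sym z'↦i))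
    bound : ∀ zs → AllPairs _≺_ zs → (∀ {z} → z ∈ zs → z ∈ C × letter z ≡ i) → length zs ≤ 2
    bound [] _ _ = z≤n
    bound (_ ∷ []) _ _ = s≤s z≤n
    bound (_ ∷ _ ∷ []) _ _ = s≤s (s≤s z≤n)
    bound (p ∷ q ∷ r ∷ _) ((p≺q ∷ p≺r ∷ _) ∷ (q≺r ∷ _) ∷ _) info =
      ⊥-elim (no-three-in-a-row (proj₁ p-info) (proj₁ q-info) (proj₁ r-info) (≺⇒≢ p≺q) (≺⇒≢ q≺r) (≺⇒≢ p≺r)
                                (row p-info q-info , row q-info r-info))
      where
      p-info : p ∈ C × letter p ≡ i
      p-info = info (here refl)
      q-info : q ∈ C × letter q ≡ i
      q-info = info (there (here refl))
      r-info : r ∈ C × letter r ≡ i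
      r-info = info (there (there (here refl)))

lemma4p3 : (N : ℕ) (C : List Point) →
    All InT C → AllPairs _≺_ C → Admissible C →
    ValidWord N (wordOf C) →
    Reduced N (wordOf C) × Avoids321 N (wordOf C) × TwoRepeating N (wordOf C)
lemma4p3 N C C⊆T sorted adm valid = reduced valid lettersCross , avoids321 valid lettersCross , two-repeating
  where
  open Configuration C⊆T sorted adm
  two-repeating : TwoRepeating N (wordOf C)
  two-repeating w' valid' w'≈w reduced' i =
    ≤-trans (reduced-count-≤ valid lettersCross w' valid' w'≈w reduced' i) (at-most-two-per-letter i)
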